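{- For every integer $k\ge1$, \[ \Omega(Z_{2k+1};t)=(-1)^k\binom{t+k}{2k+1}+\sum_{i=1}^{k}(-1)^{i+1}\binom{t+i}{2i}\,\Omega(Z_{2(k-i)+1};t) \] and \[ \Omega(Z_{2k};t)=\sum_{i=1}^{k}(-1)^{i+1}\binom{t+i}{2i}\,\Omega(Z_{2(k-i)};t). \]
   Context: The zigzag poset $Z_n$ has ground set $\{z_1,\dots,z_n\}$ with cover relations $z_1>z_2<z_3>z_4<\cdots$; $Z_0$ is the empty poset with $\Omega(Z_0;t)=1$. The order polynomial $\Omega(P;t)$ is the unique polynomial whose value at each positive integer $t$ is the number of maps $f:P\to\{1,\dots,t\}$ with $f(x)\le f(y)$ whenever $x\preceq y$. For an integer $m\ge0$, $\binom{t+i}{m}$ denotes the polynomial $(t+i)(t+i-1)\cdots(t+i-m+1)/m!$ in $t$. -}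

module Defs where

open import Data.Nat using (ℕ; zero; suc; _+_; _*_; _≤_; _%_; _≟_; _≤?_)
open import Data.Fin using (Fin; toℕ)
open import Data.Fin.Properties using (all?)
open import Data.Vec using (Vec; []; _∷_; lookup)
open import Data.List using (List; [_]; concatMap; map; filter; length)
open import Data.List.Base using () renaming (allFin to allFinL)
open import Data.Sum using (_⊎_)
open import Data.Product using (_×_)
open import Relation.Binary.PropositionalEquality using (_≡_)
open import Relation.Nullary using (Dec)
open import Relation.Nullary.Decidable using (_⊎-dec_; _×-dec_; _→-dec_)
open import Data.Integer as ℤ using (ℤ; +_)

-- The zigzag poset Z_n on Fin n (index j ↦ z_{j+1}), covers z₁ > z₂ < z₃ > z₄ < ⋯.
-- Its partial order (reflexive closure of the covers; chains have length ≤ 2):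
--   x ⪯ y  iff  x = y,
--          or  y = x+1 with x odd (0-based), i.e. z_{2m} < z_{2m+1},
--          or  x = y+1 with y even (0-based), i.e. z_{2m+2} < z_{2m+1}.
_⪯Z_ : {n : ℕ} → Fin n → Fin n → Set
x ⪯Z y = (toℕ x ≡ toℕ y)
       ⊎ ((toℕ y ≡ suc (toℕ x)) × (toℕ x % 2 ≡ 1))
       ⊎ ((toℕ x ≡ suc (toℕ y)) × (toℕ y % 2 ≡ 0))

⪯Z? : {n : ℕ} (x y : Fin n) → Dec (x ⪯Z y)
⪯Z? x y = (toℕ x ≟ toℕ y)
        ⊎-dec ((toℕ y ≟ suc (toℕ x)) ×-dec (toℕ x % 2 ≟ 1))
        ⊎-dec ((toℕ x ≟ suc (toℕ y)) ×-dec (toℕ y % 2 ≟ 0))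

-- All maps Z_n → {1,…,t}, encoded as vectors over Fin t (value j ↦ j+1).
allMaps : (n t : ℕ) → List (Vec (Fin t) n)
allMaps zero    t = [ [] ]
allMaps (suc n) t = concatMap (λ v → map (_∷ v) (allFinL t)) (allMaps n t)

OrderPreserving : {n t : ℕ} → Vec (Fin t) n → Set
OrderPreserving {n} f = ∀ x y → x ⪯Z y → toℕ (lookup f x) ≤ toℕ (lookup f y)

orderPreserving? : {n t : ℕ} (f : Vec (Fin t) n) → Dec (OrderPreserving f)
orderPreserving? f = all? λ x → all? λ y → ⪯Z? x y →-dec (toℕ (lookup f x) ≤? toℕ (lookup f y))

Ω : (n t : ℕ) → ℕ
Ω n t = length (filter orderPreserving? (allMaps n t))

Σ₁ : ℕ → (ℕ → ℤ) → ℤ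
Σ₁ zero    f = + 0
Σ₁ (suc k) f = Σ₁ k f ℤ.+ f (suc k)

-- Sweep along the zigzag, keeping for each value y ∈ [t] of the current element the number g y
-- of ways to fill the elements already passed.  Passing a descent or an ascent replaces g by
-- Σ≥ g (y ↦ Σ_{x ≥ y} g x) or Σ≤ g, so Ω(Z_{2m+1}; t) = ⟨T^m 1⟩ and Ω(Z_{2m+2}; t) = ⟨Σ≥ T^m 1⟩
-- for T = Σ≤ ∘ Σ≥ and ⟨g⟩ = Σ_y g y.  Since Σ≤ q y + Σ> q y = ⟨q⟩ for every y, linearity gives
--   ⟨Σ≥ p⟩ · ⟨F (T^m 1)⟩ = ⟨F (T^(m+1) p)⟩ + ⟨F (T^m (Σ> Σ≥ p))⟩      (F = id or Σ≥).
-- Iterating p ↦ Σ> Σ≥ p from p = 1 yields x ↦ C(t-1-x+j, 2j) by the hockey-stick identity,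
-- and with these p every product in the recurrences splits in two, so the alternating sums
-- telescope.
module Submission where

open import Defs
open import Data.Bool using (Bool; true; false; not; if_then_else_)
open import Data.Fin using (Fin; zero; suc; toℕ)
open import Data.Fin.Properties using (toℕ<n; toℕ-injective)
open import Data.Integer using (ℤ; +_; -1ℤ; _^_) renaming (_+_ to _+ℤ_; _*_ to _*ℤ_)
open import Data.Integer.Properties using (pos-*; pos-+) renaming (*-assoc to *ℤ-assoc)
import Data.Integer.Tactic.RingSolver as ℤ-Solver
open import Data.List using (List; []; _∷_; _++_; map; filter; length; concatMap; tabulate)
open import Data.List.Base using () renaming (allFin to allFinL)
open import Data.List.Properties using (map-++; map-∘; map-cong; map-tabulate)
open import Data.Nat using (ℕ; zero; suc; _+_; _*_; _∸_; _%_; _≤_; _<_; s≤s; s≤s⁻¹)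
open import Data.Nat.Combinatorics using (_C_; k>n⇒nCk≡0; nCk+nC[k+1]≡[n+1]C[k+1])
open import Data.Nat.GeneralisedArithmetic using (iterate)
open import Data.Nat.ListAction using (sum)
open import Data.Nat.ListAction.Properties using (sum-++)
open import Data.Nat.Properties
  using (_≤?_; _<?_; ≤-reflexive; <⇒≱; ≰⇒>; suc-injective; m≤m+n; m<n⇒m<1+n;
         n<1+n; +-comm; +-suc; +-∸-assoc; 0∸n≡0; n∸n≡0; +-identityʳ; *-identityˡ; *-identityʳ;
         *-distribˡ-+; *-distribʳ-+; +-*-semiring; *-commutativeSemigroup)
import Data.Nat.Tactic.RingSolver as ℕ-Solver
open import Algebra.Properties.Semiring.Sum +-*-semiring
  using (sum-syntax; sum-cong-≗; ∑-distrib-+; *-distribˡ-sum)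
open import Algebra.Properties.CommutativeSemigroup *-commutativeSemigroup
  using (x∙yz≈y∙xz; xy∙z≈y∙xz)
open import Data.Product using (_×_; _,_)
open import Data.Sum using (inj₁; inj₂)
open import Data.Unit using (⊤; tt)
open import Data.Vec using (Vec; []; _∷_; lookup; head)
open import Function using (_∘_; _⇔_; mk⇔)
open import Relation.Binary.PropositionalEquality
  using (_≡_; _≗_; refl; sym; trans; cong; cong₂; module ≡-Reasoning)
open import Relation.Nullary using (Dec; yes; no; does; contradiction)
open import Relation.Nullary.Decidable using (_×-dec_; does-⇔)
open import Relation.Unary using (Pred; Decidable)

open ≡-Reasoning

𝟙 : ∀ {p} {P : Set p} → Dec P → ℕ
𝟙 P? = if does P? then 1 else 0

𝟙-⇔ : ∀ {p q} {P : Set p} {Q : Set q} → P ⇔ Q → (P? : Dec P) (Q? : Dec Q) → 𝟙 P? ≡ 𝟙 Q?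
𝟙-⇔ P⇔Q P? Q? = cong (λ b → if b then 1 else 0) (does-⇔ P⇔Q P? Q?)

𝟙-×-dec : ∀ {p q} {P : Set p} {Q : Set q} (P? : Dec P) (Q? : Dec Q) →
          𝟙 (P? ×-dec Q?) ≡ 𝟙 P? * 𝟙 Q?
𝟙-×-dec (yes _) Q? = sym (*-identityˡ (𝟙 Q?))
𝟙-×-dec (no _)  Q? = refl

𝟙-s≤s : ∀ m n → 𝟙 (suc m ≤? suc n) ≡ 𝟙 (m ≤? n)
𝟙-s≤s m n = 𝟙-⇔ (mk⇔ s≤s⁻¹ s≤s) (suc m ≤? suc n) (m ≤? n)

𝟙-≤+𝟙-> : ∀ m n → 𝟙 (m ≤? n) + 𝟙 (n <? m) ≡ 1
𝟙-≤+𝟙-> m n = dichotomy (m ≤? n) (n <? m)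
  where
  dichotomy : (m≤n? : Dec (m ≤ n)) (n<m? : Dec (n < m)) → 𝟙 m≤n? + 𝟙 n<m? ≡ 1
  dichotomy (yes _)   (no _)    = refl
  dichotomy (no _)    (yes _)   = refl
  dichotomy (yes m≤n) (yes n<m) = contradiction m≤n (<⇒≱ n<m)
  dichotomy (no m≰n)  (no n≮m)  = contradiction (≰⇒> m≰n) n≮m

length-filter≡sum-𝟙 : ∀ {a p} {A : Set a} {P : Pred A p} (P? : Decidable P) (xs : List A) →
                      length (filter P? xs) ≡ sum (map (𝟙 ∘ P?) xs)
length-filter≡sum-𝟙 P? []       = refl
length-filter≡sum-𝟙 P? (x ∷ xs) with P? x
... | yes _ = cong suc (length-filter≡sum-𝟙 P? xs)
... | no _  = length-filter≡sum-𝟙 P? xs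

sum-map-concatMap : ∀ {a b} {A : Set a} {B : Set b} (w : B → ℕ) (h : A → List B) (xs : List A) →
                    sum (map w (concatMap h xs)) ≡ sum (map (sum ∘ map w ∘ h) xs)
sum-map-concatMap w h []       = refl
sum-map-concatMap w h (x ∷ xs) = begin
  sum (map w (h x ++ concatMap h xs))               ≡⟨ cong sum (map-++ w (h x) _) ⟩
  sum (map w (h x) ++ map w (concatMap h xs))       ≡⟨ sum-++ (map w (h x)) _ ⟩
  sum (map w (h x)) + sum (map w (concatMap h xs))  ≡⟨ cong (_+_ (sum (map w (h x)))) (sum-map-concatMap w h xs) ⟩
  sum (map w (h x)) + sum (map (sum ∘ map w ∘ h) xs) ∎

sum-tabulate : ∀ {n} (h : Fin n → ℕ) → sum (tabulate h) ≡ ∑[ i < n ] h i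
sum-tabulate {zero}  h = refl
sum-tabulate {suc n} h = cong (_+_ (h zero)) (sum-tabulate (h ∘ suc))

sum-map-allMaps : ∀ n t (w : Vec (Fin t) (suc n) → ℕ) →
                  sum (map w (allMaps (suc n) t)) ≡ sum (map (λ v → ∑[ x < t ] w (x ∷ v)) (allMaps n t))
sum-map-allMaps n t w = trans (sum-map-concatMap w (λ v → map (_∷ v) (allFinL t)) (allMaps n t))
                              (cong sum (map-cong over-first (allMaps n t)))
  where
  over-first : ∀ v → sum (map w (map (_∷ v) (allFinL t))) ≡ ∑[ x < t ] w (x ∷ v)
  over-first v = begin
    sum (map w (map (_∷ v) (allFinL t)))   ≡⟨ cong sum (map-∘ (allFinL t)) ⟨
    sum (map (w ∘ (_∷ v)) (allFinL t))     ≡⟨ cong sum (map-tabulate (λ x → x) (w ∘ (_∷ v))) ⟩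
    sum (tabulate (w ∘ (_∷ v)))            ≡⟨ sum-tabulate (w ∘ (_∷ v)) ⟩
    ∑[ x < t ] w (x ∷ v)                   ∎

hockey-stick : ∀ {a b} → a ≤ b → ∀ {n} (g : Fin n → ℕ) →
               (∀ x → g x ≡ (n ∸ suc (toℕ x) + a) C b) →
               ∀ u → ∑[ x < n ] (𝟙 (u ≤? toℕ x) * g x) ≡ (n ∸ u + a) C suc b
hockey-stick {a} {b} a≤b {zero} g g≡ u = sym (begin
  (0 ∸ u + a) C suc b  ≡⟨ cong (λ m → (m + a) C suc b) (0∸n≡0 u) ⟩
  a C suc b            ≡⟨ k>n⇒nCk≡0 (s≤s a≤b) ⟩
  0                    ∎)
hockey-stick {a} {b} a≤b {suc n} g g≡ zero = begin
  1 * g zero + ∑[ x < n ] (𝟙 (0 ≤? toℕ x) * g (suc x))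
    ≡⟨ cong₂ _+_ (trans (*-identityˡ (g zero)) (g≡ zero))
                 (hockey-stick a≤b (g ∘ suc) (g≡ ∘ suc) zero) ⟩
  (n + a) C b + (n + a) C suc b
    ≡⟨ nCk+nC[k+1]≡[n+1]C[k+1] (n + a) b ⟩
  suc (n + a) C suc b ∎
hockey-stick {a} {b} a≤b {suc n} g g≡ (suc u) = begin
  ∑[ x < n ] (𝟙 (suc u ≤? suc (toℕ x)) * g (suc x))
    ≡⟨ sum-cong-≗ (λ x → cong (_* g (suc x)) (𝟙-s≤s u (toℕ x))) ⟩
  ∑[ x < n ] (𝟙 (u ≤? toℕ x) * g (suc x))
    ≡⟨ hockey-stick a≤b (g ∘ suc) (g≡ ∘ suc) u ⟩
  (n ∸ u + a) C suc b ∎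

Σ₁-cong : ∀ n {f g : ℕ → ℤ} → (∀ i → i < n → f (suc i) ≡ g (suc i)) → Σ₁ n f ≡ Σ₁ n g
Σ₁-cong zero    _  = refl
Σ₁-cong (suc n) eq = cong₂ _+ℤ_ (Σ₁-cong n (λ i i<n → eq i (m<n⇒m<1+n i<n))) (eq n (n<1+n n))

Σ₁-alternating-telescope : ∀ n (D : ℕ → ℤ) →
  Σ₁ n (λ i → (-1ℤ ^ (i + 1)) *ℤ (D i +ℤ D (suc i))) ≡ D 1 +ℤ (-1ℤ ^ (n + 1)) *ℤ D (suc n)
Σ₁-alternating-telescope zero    D = cancel (D 1)
  where
  cancel : ∀ d → + 0 ≡ d +ℤ -1ℤ *ℤ d
  cancel = ℤ-Solver.solve-∀
Σ₁-alternating-telescope (suc n) D = begin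
  Σ₁ n f +ℤ f (suc n)
    ≡⟨ cong (_+ℤ f (suc n)) (Σ₁-alternating-telescope n D) ⟩
  D 1 +ℤ s *ℤ D (suc n) +ℤ (-1ℤ *ℤ s) *ℤ (D (suc n) +ℤ D (suc (suc n)))
    ≡⟨ shift (D 1) s (D (suc n)) (D (suc (suc n))) ⟩
  D 1 +ℤ (-1ℤ *ℤ s) *ℤ D (suc (suc n)) ∎
  where
  f : ℕ → ℤ
  f i = (-1ℤ ^ (i + 1)) *ℤ (D i +ℤ D (suc i))
  s = -1ℤ ^ (n + 1)
  shift : ∀ d s a b → d +ℤ s *ℤ a +ℤ (-1ℤ *ℤ s) *ℤ (a +ℤ b) ≡ d +ℤ (-1ℤ *ℤ s) *ℤ b
  shift = ℤ-Solver.solve-∀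

-- _% 2 is invariant under adding 2 definitionally, so comparisons with OrderPreserving
-- recurse two positions at a time and need no parity bookkeeping.
⪯Z-shift₂ : ∀ {n} {x y : Fin n} → x ⪯Z y → suc (suc x) ⪯Z suc (suc y)
⪯Z-shift₂ (inj₁ x≡y)                  = inj₁ (cong (_+_ 2) x≡y)
⪯Z-shift₂ (inj₂ (inj₁ (y≡1+x , odd)))  = inj₂ (inj₁ (cong (_+_ 2) y≡1+x , odd))
⪯Z-shift₂ (inj₂ (inj₂ (x≡1+y , even))) = inj₂ (inj₂ (cong (_+_ 2) x≡1+y , even))

module _ (t : ℕ) where

  Weight : Set
  Weight = Fin t → ℕ

  one : Weight
  one _ = 1

  total : Weight → ℕ
  total g = ∑[ x < t ] g x

  act : (Fin t → Fin t → ℕ) → Weight → Weight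
  act K g y = ∑[ x < t ] (K y x * g x)

  Σ≥ Σ≤ Σ> : Weight → Weight
  Σ≥ = act λ y x → 𝟙 (toℕ y ≤? toℕ x)
  Σ≤ = act λ y x → 𝟙 (toℕ x ≤? toℕ y)
  Σ> = act λ y x → 𝟙 (toℕ y <? toℕ x)

  transfer : Weight → Weight
  transfer g = Σ≤ (Σ≥ g)

  Step : Bool → Fin t → Fin t → Set
  Step true  x y = toℕ y ≤ toℕ x
  Step false x y = toℕ x ≤ toℕ y

  step? : ∀ s x y → Dec (Step s x y)
  step? true  x y = toℕ y ≤? toℕ x
  step? false x y = toℕ x ≤? toℕ y

  Alternating : ∀ {n} → Bool → Vec (Fin t) n → Set
  Alternating s []          = ⊤
  Alternating s (x ∷ [])    = ⊤
  Alternating s (x ∷ y ∷ f) = Step s x y × Alternating (not s) (y ∷ f)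

  alternating? : ∀ {n} s (f : Vec (Fin t) n) → Dec (Alternating s f)
  alternating? s []          = yes tt
  alternating? s (x ∷ [])    = yes tt
  alternating? s (x ∷ y ∷ f) = step? s x y ×-dec alternating? (not s) (y ∷ f)

  orderPreserving→alternating : ∀ {n} (f : Vec (Fin t) n) → OrderPreserving f → Alternating true f
  orderPreserving→alternating []              _  = tt
  orderPreserving→alternating (a ∷ [])        _  = tt
  orderPreserving→alternating (a ∷ b ∷ [])    op = op (suc zero) zero (inj₂ (inj₂ (refl , refl))) , tt
  orderPreserving→alternating (a ∷ b ∷ c ∷ f) op =
    op (suc zero) zero (inj₂ (inj₂ (refl , refl))) ,
    op (suc zero) (suc (suc zero)) (inj₂ (inj₁ (refl , refl))) ,
    orderPreserving→alternating (c ∷ f) (λ x y → op (suc (suc x)) (suc (suc y)) ∘ ⪯Z-shift₂)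

  ascent : ∀ {n} (f : Vec (Fin t) n) → Alternating true f → ∀ x y →
           toℕ y ≡ suc (toℕ x) → toℕ x % 2 ≡ 1 → toℕ (lookup f x) ≤ toℕ (lookup f y)
  ascent (a ∷ b ∷ c ∷ f) (_ , b≤c , _) (suc zero) (suc (suc zero)) _ _ = b≤c
  ascent (a ∷ b ∷ c ∷ f) (_ , _ , alt) (suc (suc x)) (suc (suc y)) y≡1+x odd =
    ascent (c ∷ f) alt x y (suc-injective (suc-injective y≡1+x)) odd
  ascent f _ zero          _                     _  ()
  ascent f _ (suc zero)    zero                  () _
  ascent f _ (suc zero)    (suc zero)            () _
  ascent f _ (suc zero)    (suc (suc (suc y)))   () _
  ascent f _ (suc (suc x)) zero                  () _
  ascent f _ (suc (suc x)) (suc zero)            () _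

  descent : ∀ {n} (f : Vec (Fin t) n) → Alternating true f → ∀ x y →
            toℕ x ≡ suc (toℕ y) → toℕ y % 2 ≡ 0 → toℕ (lookup f x) ≤ toℕ (lookup f y)
  descent (a ∷ b ∷ f) (b≤a , _) (suc zero) zero _ _ = b≤a
  descent (a ∷ b ∷ c ∷ f) (_ , _ , alt) (suc (suc x)) (suc (suc y)) x≡1+y even =
    descent (c ∷ f) alt x y (suc-injective (suc-injective x≡1+y)) even
  descent f _ _             (suc zero)    _  ()
  descent f _ zero          _             () _
  descent f _ (suc zero)    (suc (suc y)) () _
  descent f _ (suc (suc x)) zero          () _

  alternating→orderPreserving : ∀ {n} (f : Vec (Fin t) n) → Alternating true f → OrderPreserving f
  alternating→orderPreserving f _   x y (inj₁ x≡y) =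
    ≤-reflexive (cong (λ z → toℕ (lookup f z)) (toℕ-injective x≡y))
  alternating→orderPreserving f alt x y (inj₂ (inj₁ (y≡1+x , odd)))  = ascent f alt x y y≡1+x odd
  alternating→orderPreserving f alt x y (inj₂ (inj₂ (x≡1+y , even))) = descent f alt x y x≡1+y even

  orderPreserving⇔alternating : ∀ {n} (f : Vec (Fin t) n) → OrderPreserving f ⇔ Alternating true f
  orderPreserving⇔alternating f = mk⇔ (orderPreserving→alternating f) (alternating→orderPreserving f)

  step : Bool → Weight → Weight
  step true  = Σ≥
  step false = Σ≤

  count : Bool → ℕ → Weight → ℕ
  count s n g = sum (map (λ f → 𝟙 (alternating? s f) * g (head f)) (allMaps (suc n) t))

  Ω≡count : ∀ n → Ω (suc n) t ≡ count true n one
  Ω≡count n = trans (length-filter≡sum-𝟙 orderPreserving? (allMaps (suc n) t))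
                    (cong sum (map-cong 𝟙-op≡𝟙-alt (allMaps (suc n) t)))
    where
    𝟙-op≡𝟙-alt : ∀ f → 𝟙 (orderPreserving? f) ≡ 𝟙 (alternating? true f) * 1
    𝟙-op≡𝟙-alt f = trans (𝟙-⇔ (orderPreserving⇔alternating f) (orderPreserving? f) (alternating? true f))
                         (sym (*-identityʳ _))

  count-zero : ∀ s g → count s 0 g ≡ total g
  count-zero s g = begin
    count s 0 g                  ≡⟨ sum-map-allMaps 0 t _ ⟩
    ∑[ x < t ] (1 * g x) + 0      ≡⟨ +-identityʳ _ ⟩
    ∑[ x < t ] (1 * g x)          ≡⟨ sum-cong-≗ (λ x → *-identityˡ (g x)) ⟩
    total g                      ∎

  count-suc : ∀ s n g → count s (suc n) g ≡ count (not s) n (step s g)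
  count-suc s n g = trans (sum-map-allMaps (suc n) t _) (cong sum (map-cong place-head (allMaps (suc n) t)))
    where
    ∑-𝟙-step : ∀ s y → ∑[ x < t ] (𝟙 (step? s x y) * g x) ≡ step s g y
    ∑-𝟙-step true  y = refl
    ∑-𝟙-step false y = refl

    place-head : ∀ (v : Vec (Fin t) (suc n)) →
                 ∑[ x < t ] (𝟙 (alternating? s (x ∷ v)) * g x) ≡ 𝟙 (alternating? (not s) v) * step s g (head v)
    place-head (y ∷ r) = begin
      ∑[ x < t ] (𝟙 (step? s x y ×-dec rest?) * g x)
        ≡⟨ sum-cong-≗ (λ x → trans (cong (_* g x) (𝟙-×-dec (step? s x y) rest?))
                                   (xy∙z≈y∙xz (𝟙 (step? s x y)) (𝟙 rest?) (g x))) ⟩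
      ∑[ x < t ] (𝟙 rest? * (𝟙 (step? s x y) * g x))
        ≡⟨ *-distribˡ-sum (𝟙 rest?) (λ x → 𝟙 (step? s x y) * g x) ⟨
      𝟙 rest? * ∑[ x < t ] (𝟙 (step? s x y) * g x)
        ≡⟨ cong (𝟙 rest? *_) (∑-𝟙-step s y) ⟩
      𝟙 rest? * step s g y ∎
      where rest? = alternating? (not s) (y ∷ r)

  count-iterate : ∀ m n g → count true (m * 2 + n) g ≡ count true n (iterate transfer g m)
  count-iterate zero    n g = refl
  count-iterate (suc m) n g = begin
    count true (suc (suc (m * 2 + n))) g  ≡⟨ count-suc true (suc (m * 2 + n)) g ⟩
    count false (suc (m * 2 + n)) (Σ≥ g)  ≡⟨ count-suc false (m * 2 + n) (Σ≥ g) ⟩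
    count true (m * 2 + n) (transfer g)   ≡⟨ count-iterate m n (transfer g) ⟩
    count true n (iterate transfer g (suc m)) ∎

  Ω-odd : ∀ m → Ω (2 * m + 1) t ≡ total (iterate transfer one m)
  Ω-odd m = begin
    Ω (2 * m + 1) t                        ≡⟨ cong (λ n → Ω n t) (size m) ⟩
    Ω (suc (m * 2 + 0)) t                  ≡⟨ Ω≡count (m * 2 + 0) ⟩
    count true (m * 2 + 0) one             ≡⟨ count-iterate m 0 one ⟩
    count true 0 (iterate transfer one m)  ≡⟨ count-zero true _ ⟩
    total (iterate transfer one m)         ∎
    where
    size : ∀ m → 2 * m + 1 ≡ suc (m * 2 + 0)
    size = ℕ-Solver.solve-∀

  Ω-even : ∀ m → Ω (2 * suc m) t ≡ total (Σ≥ (iterate transfer one m))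
  Ω-even m = begin
    Ω (2 * suc m) t                              ≡⟨ cong (λ n → Ω n t) (size m) ⟩
    Ω (suc (m * 2 + 1)) t                        ≡⟨ Ω≡count (m * 2 + 1) ⟩
    count true (m * 2 + 1) one                   ≡⟨ count-iterate m 1 one ⟩
    count true 1 (iterate transfer one m)        ≡⟨ count-suc true 0 _ ⟩
    count false 0 (Σ≥ (iterate transfer one m))  ≡⟨ count-zero false _ ⟩
    total (Σ≥ (iterate transfer one m))          ∎
    where
    size : ∀ m → 2 * suc m ≡ suc (m * 2 + 1)
    size = ℕ-Solver.solve-∀

  record IsLinear (F : Weight → Weight) : Set where
    field
      ≗-cong : ∀ {g h} → g ≗ h → F g ≗ F h
      *-homo : ∀ c g → F (λ x → c * g x) ≗ λ y → c * F g y
      +-homo : ∀ g h → F (λ x → g x + h x) ≗ λ y → F g y + F h y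

  id-isLinear : IsLinear (λ g → g)
  id-isLinear = record { ≗-cong = λ g≗h → g≗h ; *-homo = λ _ _ _ → refl ; +-homo = λ _ _ _ → refl }

  ∘-isLinear : ∀ {F G} → IsLinear F → IsLinear G → IsLinear (λ g → F (G g))
  ∘-isLinear {F} {G} F-lin G-lin = record
    { ≗-cong = λ g≗h → F.≗-cong (G.≗-cong g≗h)
    ; *-homo = λ c g y → trans (F.≗-cong (G.*-homo c g) y) (F.*-homo c (G g) y)
    ; +-homo = λ g h y → trans (F.≗-cong (G.+-homo g h) y) (F.+-homo (G g) (G h) y)
    }
    where
    module F = IsLinear F-lin
    module G = IsLinear G-lin

  iterate-isLinear : ∀ {F} → IsLinear F → ∀ m → IsLinear (λ g → iterate F g m)
  iterate-isLinear F-lin zero    = id-isLinear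
  iterate-isLinear F-lin (suc m) = ∘-isLinear (iterate-isLinear F-lin m) F-lin

  act-isLinear : ∀ K → IsLinear (act K)
  act-isLinear K = record
    { ≗-cong = λ g≗h y → sum-cong-≗ (λ x → cong (K y x *_) (g≗h x))
    ; *-homo = λ c g y → trans (sum-cong-≗ (λ x → x∙yz≈y∙xz (K y x) c (g x)))
                               (sym (*-distribˡ-sum c (λ x → K y x * g x)))
    ; +-homo = λ g h y → trans (sum-cong-≗ (λ x → *-distribˡ-+ (K y x) (g x) (h x)))
                               (∑-distrib-+ (λ x → K y x * g x) (λ x → K y x * h x))
    }

  Σ≥-isLinear : IsLinear Σ≥
  Σ≥-isLinear = act-isLinear λ y x → 𝟙 (toℕ y ≤? toℕ x)

  transfer-isLinear : IsLinear transfer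
  transfer-isLinear = ∘-isLinear (act-isLinear λ y x → 𝟙 (toℕ x ≤? toℕ y)) Σ≥-isLinear

  Σ≤+Σ>≡total : ∀ g y → Σ≤ g y + Σ> g y ≡ total g
  Σ≤+Σ>≡total g y = trans (sym (∑-distrib-+ (λ x → le x * g x) (λ x → gt x * g x))) (sum-cong-≗ λ x → begin
    le x * g x + gt x * g x  ≡⟨ *-distribʳ-+ (g x) (le x) (gt x) ⟨
    (le x + gt x) * g x      ≡⟨ cong (_* g x) (𝟙-≤+𝟙-> (toℕ x) (toℕ y)) ⟩
    1 * g x                  ≡⟨ *-identityˡ (g x) ⟩
    g x                      ∎)
    where
    le gt : Fin t → ℕ
    le x = 𝟙 (toℕ x ≤? toℕ y)
    gt x = 𝟙 (toℕ y <? toℕ x)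

  total-Σ≥-*-split : ∀ {M} → IsLinear M → ∀ p →
    total (Σ≥ p) * total (M one) ≡ total (M (transfer p)) + total (M (Σ> (Σ≥ p)))
  total-Σ≥-*-split {M} M-lin p = begin
    c * total (M one)                        ≡⟨ *-distribˡ-sum c (M one) ⟩
    total (λ y → c * M one y)                ≡⟨ sum-cong-≗ (M.*-homo c one) ⟨
    total (M (λ _ → c * 1))                  ≡⟨ sum-cong-≗ (M.≗-cong c≗Σ≤+Σ>) ⟩
    total (M (λ y → Σ≤ q y + Σ> q y))        ≡⟨ sum-cong-≗ (M.+-homo (Σ≤ q) (Σ> q)) ⟩
    total (λ y → M (Σ≤ q) y + M (Σ> q) y)    ≡⟨ ∑-distrib-+ (M (Σ≤ q)) (M (Σ> q)) ⟩
    total (M (Σ≤ q)) + total (M (Σ> q))      ∎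
    where
    module M = IsLinear M-lin
    q = Σ≥ p
    c = total q
    c≗Σ≤+Σ> : (λ _ → c * 1) ≗ λ y → Σ≤ q y + Σ> q y
    c≗Σ≤+Σ> y = trans (*-identityʳ c) (sym (Σ≤+Σ>≡total q y))

  chains : ℕ → Weight
  chains zero    = one
  chains (suc j) = Σ> (Σ≥ (chains j))

  chains-binomial    : ∀ j x → chains j x ≡ (t ∸ suc (toℕ x) + j) C (j + j)
  Σ≥-chains-binomial : ∀ j y → Σ≥ (chains j) y ≡ (t ∸ suc (toℕ y) + suc j) C suc (j + j)
  chains-binomial zero    x = refl
  chains-binomial (suc j) x = begin
    Σ> (Σ≥ (chains j)) x
      ≡⟨ hockey-stick (s≤s (m≤m+n j j)) (Σ≥ (chains j)) (Σ≥-chains-binomial j) (suc (toℕ x)) ⟩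
    (t ∸ suc (toℕ x) + suc j) C suc (suc (j + j))
      ≡⟨ cong (λ k → (t ∸ suc (toℕ x) + suc j) C suc k) (+-suc j j) ⟨
    (t ∸ suc (toℕ x) + suc j) C (suc j + suc j) ∎
  Σ≥-chains-binomial j y = begin
    Σ≥ (chains j) y
      ≡⟨ hockey-stick (m≤m+n j j) (chains j) (chains-binomial j) (toℕ y) ⟩
    (t ∸ toℕ y + j) C suc (j + j)
      ≡⟨ cong (λ m → (m + j) C suc (j + j)) (+-∸-assoc 1 (toℕ<n y)) ⟩
    (suc (t ∸ suc (toℕ y)) + j) C suc (j + j)
      ≡⟨ cong (_C suc (j + j)) (+-suc (t ∸ suc (toℕ y)) j) ⟨
    (t ∸ suc (toℕ y) + suc j) C suc (j + j) ∎

  total≡∑𝟙0≤ : ∀ g → total g ≡ ∑[ x < t ] (𝟙 (0 ≤? toℕ x) * g x)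
  total≡∑𝟙0≤ g = sum-cong-≗ (λ x → sym (*-identityˡ (g x)))

  total-chains : ∀ k → total (chains k) ≡ (t + k) C (2 * k + 1)
  total-chains k = begin
    total (chains k)       ≡⟨ total≡∑𝟙0≤ (chains k) ⟩
    _                      ≡⟨ hockey-stick (m≤m+n k k) (chains k) (chains-binomial k) 0 ⟩
    (t + k) C suc (k + k)  ≡⟨ cong ((t + k) C_) (size k) ⟩
    (t + k) C (2 * k + 1)  ∎
    where
    size : ∀ k → suc (k + k) ≡ 2 * k + 1
    size = ℕ-Solver.solve-∀

  total-Σ≥-chains : ∀ j → total (Σ≥ (chains j)) ≡ (t + suc j) C (2 * suc j)
  total-Σ≥-chains j = begin
    total (Σ≥ (chains j))               ≡⟨ total≡∑𝟙0≤ (Σ≥ (chains j)) ⟩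
    _                                   ≡⟨ hockey-stick (s≤s (m≤m+n j j)) (Σ≥ (chains j)) (Σ≥-chains-binomial j) 0 ⟩
    (t + suc j) C suc (suc (j + j))     ≡⟨ cong ((t + suc j) C_) (size j) ⟩
    (t + suc j) C (2 * suc j)           ∎
    where
    size : ∀ j → suc (suc (j + j)) ≡ 2 * suc j
    size = ℕ-Solver.solve-∀

  alternating-sum : ∀ {F} → IsLinear F → ∀ k →
    Σ₁ k (λ i → (-1ℤ ^ (i + 1)) *ℤ + total (Σ≥ (chains (i ∸ 1))) *ℤ + total (F (iterate transfer one (k ∸ i))))
      ≡ + total (F (iterate transfer one k)) +ℤ (-1ℤ ^ (k + 1)) *ℤ + total (F (chains k))
  alternating-sum {F} F-lin k = begin
    Σ₁ k _                                              ≡⟨ Σ₁-cong k split ⟩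
    Σ₁ k (λ i → (-1ℤ ^ (i + 1)) *ℤ (D i +ℤ D (suc i)))  ≡⟨ Σ₁-alternating-telescope k D ⟩
    D 1 +ℤ (-1ℤ ^ (k + 1)) *ℤ T (chains k) (k ∸ k)      ≡⟨ cong (λ m → D 1 +ℤ (-1ℤ ^ (k + 1)) *ℤ T (chains k) m) (n∸n≡0 k) ⟩
    D 1 +ℤ (-1ℤ ^ (k + 1)) *ℤ + total (F (chains k))    ∎
    where
    T : Weight → ℕ → ℤ
    T p m = + total (F (iterate transfer p m))

    D : ℕ → ℤ
    D i = T (chains (i ∸ 1)) (suc k ∸ i)

    split : ∀ j → j < k →
      (-1ℤ ^ (suc j + 1)) *ℤ + total (Σ≥ (chains j)) *ℤ + total (F (iterate transfer one (k ∸ suc j)))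
        ≡ (-1ℤ ^ (suc j + 1)) *ℤ (D (suc j) +ℤ D (suc (suc j)))
    split j j<k = begin
      s *ℤ + c *ℤ + total (M one)          ≡⟨ *ℤ-assoc s (+ c) _ ⟩
      s *ℤ (+ c *ℤ + total (M one))        ≡⟨ cong (s *ℤ_) (pos-* c _) ⟨
      s *ℤ + (c * total (M one))           ≡⟨ cong (λ n → s *ℤ + n) (total-Σ≥-*-split M-lin (chains j)) ⟩
      s *ℤ + (X + Y)                       ≡⟨ cong (s *ℤ_) (pos-+ X Y) ⟩
      s *ℤ (+ X +ℤ + Y)                    ≡⟨ cong (λ m → s *ℤ (T (chains j) m +ℤ + Y)) (+-∸-assoc 1 j<k) ⟨
      s *ℤ (D (suc j) +ℤ D (suc (suc j)))  ∎
      where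
      s = -1ℤ ^ (suc j + 1)
      c = total (Σ≥ (chains j))
      M = λ g → F (iterate transfer g (k ∸ suc j))
      M-lin : IsLinear M
      M-lin = ∘-isLinear F-lin (iterate-isLinear transfer-isLinear (k ∸ suc j))
      X = total (M (transfer (chains j)))
      Y = total (M (chains (suc j)))

  Ω-odd-recurrence : ∀ k →
    + Ω (2 * k + 1) t ≡ (-1ℤ ^ k) *ℤ + ((t + k) C (2 * k + 1))
        +ℤ Σ₁ k (λ i → (-1ℤ ^ (i + 1)) *ℤ + ((t + i) C (2 * i)) *ℤ + Ω (2 * (k ∸ i) + 1) t)
  Ω-odd-recurrence k = begin
    + Ω (2 * k + 1) t                        ≡⟨ cong +_ (Ω-odd k) ⟩
    + O                                      ≡⟨ split-off (+ O) s (+ β) ⟩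
    s *ℤ + β +ℤ (+ O +ℤ (-1ℤ *ℤ s) *ℤ + β)   ≡⟨ cong (s *ℤ + β +ℤ_) telescoped ⟨
    s *ℤ + β +ℤ Σ₁ k summand                 ∎
    where
    O = total (iterate transfer one k)
    β = (t + k) C (2 * k + 1)
    s = -1ℤ ^ k

    summand : ℕ → ℤ
    summand i = (-1ℤ ^ (i + 1)) *ℤ + ((t + i) C (2 * i)) *ℤ + Ω (2 * (k ∸ i) + 1) t

    telescoped : Σ₁ k summand ≡ + O +ℤ (-1ℤ *ℤ s) *ℤ + β
    telescoped = begin
      Σ₁ k summand
        ≡⟨ Σ₁-cong k (λ j _ → cong₂ (λ c o → (-1ℤ ^ (suc j + 1)) *ℤ + c *ℤ + o)
                                      (sym (total-Σ≥-chains j)) (Ω-odd (k ∸ suc j))) ⟩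
      Σ₁ k (λ i → (-1ℤ ^ (i + 1)) *ℤ + total (Σ≥ (chains (i ∸ 1))) *ℤ + total (iterate transfer one (k ∸ i)))
        ≡⟨ alternating-sum id-isLinear k ⟩
      + O +ℤ (-1ℤ ^ (k + 1)) *ℤ + total (chains k)
        ≡⟨ cong₂ (λ r c → + O +ℤ r *ℤ + c) (cong (-1ℤ ^_) (+-comm k 1)) (total-chains k) ⟩
      + O +ℤ (-1ℤ *ℤ s) *ℤ + β ∎

    split-off : ∀ o s c → o ≡ s *ℤ c +ℤ (o +ℤ (-1ℤ *ℤ s) *ℤ c)
    split-off = ℤ-Solver.solve-∀

  Ω-even-recurrence : ∀ k →
    + Ω (2 * suc k) t ≡ Σ₁ (suc k) (λ i → (-1ℤ ^ (i + 1)) *ℤ + ((t + i) C (2 * i)) *ℤ + Ω (2 * (suc k ∸ i)) t)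
  Ω-even-recurrence k = begin
    + Ω (2 * suc k) t                                ≡⟨ cong +_ (Ω-even k) ⟩
    + E                                              ≡⟨ absorb-last (+ E) s (+ β) ⟩
    + E +ℤ s *ℤ + β +ℤ (-1ℤ *ℤ s) *ℤ + β *ℤ + 1       ≡⟨ cong₂ _+ℤ_ telescoped last ⟨
    Σ₁ k summand +ℤ summand (suc k)                  ∎
    where
    E = total (Σ≥ (iterate transfer one k))
    β = total (Σ≥ (chains k))
    s = -1ℤ ^ (k + 1)

    summand : ℕ → ℤ
    summand i = (-1ℤ ^ (i + 1)) *ℤ + ((t + i) C (2 * i)) *ℤ + Ω (2 * (suc k ∸ i)) t

    Ω-even-below : ∀ j → j < k → Ω (2 * (k ∸ j)) t ≡ total (Σ≥ (iterate transfer one (k ∸ suc j)))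
    Ω-even-below j j<k = trans (cong (λ m → Ω (2 * m) t) (+-∸-assoc 1 j<k)) (Ω-even (k ∸ suc j))

    telescoped : Σ₁ k summand ≡ + E +ℤ s *ℤ + β
    telescoped = begin
      Σ₁ k summand
        ≡⟨ Σ₁-cong k (λ j j<k → cong₂ (λ c o → (-1ℤ ^ (suc j + 1)) *ℤ + c *ℤ + o)
                                        (sym (total-Σ≥-chains j)) (Ω-even-below j j<k)) ⟩
      Σ₁ k (λ i → (-1ℤ ^ (i + 1)) *ℤ + total (Σ≥ (chains (i ∸ 1))) *ℤ + total (Σ≥ (iterate transfer one (k ∸ i))))
        ≡⟨ alternating-sum Σ≥-isLinear k ⟩
      + E +ℤ s *ℤ + β ∎

    last : summand (suc k) ≡ (-1ℤ *ℤ s) *ℤ + β *ℤ + 1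
    last = cong₂ (λ c o → (-1ℤ *ℤ s) *ℤ + c *ℤ + o)
                 (sym (total-Σ≥-chains k)) (cong (λ m → Ω (2 * m) t) (n∸n≡0 k))

    absorb-last : ∀ e s c → e ≡ e +ℤ s *ℤ c +ℤ (-1ℤ *ℤ s) *ℤ c *ℤ + 1
    absorb-last = ℤ-Solver.solve-∀

-- The identities hold for t = 0 as well.
proposition4p4 : (k : ℕ) → 1 ≤ k → (t : ℕ) → 1 ≤ t →
    (+ Ω (2 * k + 1) t ≡ (-1ℤ ^ k) *ℤ + ((t + k) C (2 * k + 1))
        +ℤ Σ₁ k (λ i → (-1ℤ ^ (i + 1)) *ℤ + ((t + i) C (2 * i)) *ℤ + Ω (2 * (k ∸ i) + 1) t))
    × (+ Ω (2 * k) t ≡ Σ₁ k (λ i → (-1ℤ ^ (i + 1)) *ℤ + ((t + i) C (2 * i)) *ℤ + Ω (2 * (k ∸ i)) t))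
proposition4p4 (suc k) _ t _ = Ω-odd-recurrence t (suc k) , Ω-even-recurrence t k
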